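{- Let $G=(V,E)$ be a graph, $C$ a clique of $G$ and $A\in\mathcal{A}_G(C)$. Then the generating function $N_G(A,C,x)=\sum_{N\in\mathcal{N}_G(A,C)}x^{|N|}$ satisfies \[N_G(A,C,x)=P_G(A,C,x)\left((1+x)^{|C|}-x^{|A|}(1+x)^{|C|-|A|}\right).\]
   Context: All graphs are finite, simple and undirected; $N_G(v)$ is the set of neighbors of $v$. For $W\subseteq V$ let $N_G^{\cap}(W)=\bigcap_{w\in W}N_G(w)$ (with $N_G^{\cap}(\emptyset)=V$) and $N_G^{\cup}(W)=\bigcup_{w\in W}N_G(w)$. For a clique $C$, the periphery is $P_G(C)=N_G^{\cup}(C)\setminus C$; for $M\subseteq P_G(C)$ the corresponding anchor set is $A_G(M,C)=N_G^{\cap}(M)\cap C$ when non-empty; $\mathcal{A}_G(C)=\{A\subseteq C\mid A\neq\emptyset,\ \exists M\subseteq P_G(C): A=A_G(M,C)\}$; $\mathcal{P}_G(A,C)=\{M\subseteq P_G(C)\mid A_G(M,C)=A\}$ and $P_G(A,C,x)=\sum_{M\in\mathcal{P}_G(A,C)}x^{|M|}$. For $U\subseteq V$, $\mathcal{N}_G(U)=\{W\subseteq V\mid \exists v\in U: W\subseteq N_G(v)\}$. For $A\in\mathcal{A}_G(C)$, $\mathcal{N}_G(A,C)=\{N\in\mathcal{N}_G(C)\mid N\cap P_G(C)\in\mathcal{P}_G(A,C)\}$. -}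

module Defs where

open import Data.Nat using (ℕ)
import Agda.Primitive
open import Data.Bool using (Bool; true; false)
import Data.Bool as Bool
open import Data.Fin using (Fin)
open import Data.Fin.Subset using (Subset; _∈_; _⊆_; _∩_; _─_; ⋂; ⋃; Nonempty; ∣_∣; inside; outside)
open import Data.Fin.Subset.Properties using (_∈?_; _⊆?_)
open import Data.Fin.Properties using (any?)
open import Data.Vec using (Vec; []; _∷_; tabulate)
import Data.Vec.Properties as VecP
open import Data.List using (List; []; _∷_; _++_; map; filter; foldr; allFin)
open import Data.Integer using (ℤ; 0ℤ; _+_; _*_; _^_)
open import Data.Product using (Σ; ∃; _×_; _,_)
open import Relation.Binary.PropositionalEquality using (_≡_; _≢_)
open import Relation.Nullary using (Dec; yes; no; ¬_)
open import Relation.Nullary.Decidable using (_×-dec_)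
open import Relation.Unary using (Pred; Decidable)

record Graph (n : ℕ) : Set where
  field
    adj    : Fin n → Fin n → Bool
    sym    : ∀ u v → adj u v ≡ adj v u
    irrefl : ∀ v → adj v v ≡ false

module _ {n : ℕ} (G : Graph n) where
  open Graph G

  Nbh : Fin n → Subset n
  Nbh v = tabulate (adj v)

  elems : Subset n → List (Fin n)
  elems W = filter (_∈? W) (allFin n)

  -- N_G^∩(W), with N_G^∩(∅) = V
  Ncap : Subset n → Subset n
  Ncap W = ⋂ (map Nbh (elems W))

  Ncup : Subset n → Subset n
  Ncup W = ⋃ (map Nbh (elems W))

  IsClique : Subset n → Set
  IsClique C = ∀ u v → u ∈ C → v ∈ C → u ≢ v → adj u v ≡ true

  Periphery : Subset n → Subset n
  Periphery C = Ncup C ─ C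

  Anchor : Subset n → Subset n → Subset n
  Anchor M C = Ncap M ∩ C

  IsAnchorSet : Subset n → Subset n → Set
  IsAnchorSet A C = Nonempty A × Σ (Subset n) (λ M → M ⊆ Periphery C × A ≡ Anchor M C)

  InP : Subset n → Subset n → Subset n → Set
  InP A C M = M ⊆ Periphery C × Anchor M C ≡ A

  InNU : Subset n → Subset n → Set
  InNU U W = ∃ λ v → v ∈ U × W ⊆ Nbh v

  InNA : Subset n → Subset n → Subset n → Set
  InNA A C N = InNU C N × InP A C (N ∩ Periphery C)

  _≟S_ : (p q : Subset n) → Dec (p ≡ q)
  _≟S_ = VecP.≡-dec Bool._≟_

  InP? : ∀ A C → Decidable (InP A C)
  InP? A C M = (M ⊆? Periphery C) ×-dec (Anchor M C ≟S A)

  InNU? : ∀ U → Decidable (InNU U)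
  InNU? U W = any? (λ v → (v ∈? U) ×-dec (W ⊆? Nbh v))

  InNA? : ∀ A C → Decidable (InNA A C)
  InNA? A C N = InNU? C N ×-dec InP? A C (N ∩ Periphery C)

allSubsets : (n : ℕ) → List (Subset n)
allSubsets ℕ.zero = [] ∷ []
allSubsets (ℕ.suc n) = map (outside ∷_) (allSubsets n) ++ map (inside ∷_) (allSubsets n)

genFun : {n : ℕ} {P : Pred (Subset n) Agda.Primitive.lzero} → Decidable P → ℤ → ℤ
genFun {n} P? x = foldr _+_ 0ℤ (map (λ S → x ^ ∣ S ∣) (filter P? (allSubsets n)))

PGen : {n : ℕ} → Graph n → Subset n → Subset n → ℤ → ℤ
PGen G A C = genFun (InP? G A C)

NGen : {n : ℕ} → Graph n → Subset n → Subset n → ℤ → ℤ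
NGen G A C = genFun (InNA? G A C)

-- Every N ∈ 𝒩_G(A,C) lies in P_G(C) ∪ C, so it splits uniquely as N = M ∪ S with
-- M ⊆ P_G(C) and S ⊆ C. A common neighbour v ∈ C of N is adjacent to all of M,
-- hence lies in A_G(M,C) = A, and is not in S because G has no loops; conversely,
-- since C is a clique, any v ∈ A ∖ S is a common neighbour of M ∪ S. So
-- N ∈ 𝒩_G(A,C) iff M ∈ 𝒫_G(A,C) and A ⊈ S, and the generating function factors as
-- P_G(A,C,x) · Σ_{S ⊆ C, A ⊈ S} x^|S|, where the second factor is
-- (1+x)^|C| minus the contribution x^|A| (1+x)^(|C|-|A|) of the supersets of A.
module Submission where

open import Defs
open import Data.Nat using (ℕ; _∸_)
open import Data.Integer using (ℤ; _+_; _-_; _*_; _^_; 1ℤ)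
open import Data.Fin.Subset using (Subset; ∣_∣)
open import Relation.Binary.PropositionalEquality using (_≡_)

import Agda.Primitive
open import Algebra.Properties.CommutativeSemigroup using (interchange)
open import Data.Bool using (Bool; true; false; not; _∧_; if_then_else_)
open import Data.Empty using (⊥; ⊥-elim)
open import Data.Fin using (Fin; zero; suc)
open import Data.Fin.Subset
  using (_∈_; _∉_; _⊆_; _∩_; _∪_; _─_; ⋂; ⋃; ⊤; inside; outside)
open import Data.Fin.Subset.Properties
  using (_⊆?_; _∈?_; drop-∷-⊆; drop-there; out⊆; s⊆s; in⊆in; p⊆q⇒∣p∣≤∣q∣; ∈⊤; ⊆-antisym;
         x∈p∩q⁺; x∈p∩q⁻; p∩q⊆q; x∈p∪q⁺; x∈p∪q⁻; p⊆p∪q; q⊆p∪q; x∈p∧x∉q⇒x∈p─q)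
open import Data.Integer using (0ℤ; -_)
open import Data.Integer.Solver using (module +-*-Solver)
open import Data.Integer.Properties
  using (+-identityˡ; +-identityʳ; +-assoc; +-inverseʳ; *-assoc; *-zeroˡ; *-zeroʳ;
         *-identityˡ; *-distribˡ-+; *-distribʳ-+; neg-distrib-+; ^-distribˡ-+-*;
         +-commutativeSemigroup)
open import Data.List using (List; []; _∷_; _++_; map; filter; foldr; allFin)
import Data.List.Membership.Propositional as List
open import Data.List.Membership.Propositional.Properties using (∈-filter⁺; ∈-filter⁻; ∈-allFin)
open import Data.List.Relation.Unary.Any using (here; there)
import Data.Nat as ℕ
open import Data.Nat.Properties using (+-suc; +-∸-assoc)
open import Data.Product using (∃; _×_; _,_; proj₁; proj₂)
open import Data.Sum using (inj₁; inj₂)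
open import Data.Vec using ([]; _∷_; here; there)
open import Data.Vec.Properties using (lookup⇒[]=; []=⇒lookup; lookup∘tabulate)
open import Function.Bundles using (_⇔_; mk⇔)
open import Relation.Binary.PropositionalEquality using (refl; sym; trans; cong; cong₂; subst; module ≡-Reasoning)
open import Relation.Nullary using (¬_; does; ¬?; yes; no)
open import Relation.Nullary.Decidable using (_×-dec_; does-⇔)
open import Relation.Unary using (Pred; Decidable)

private
  variable
    k : ℕ

_when_ : ℤ → Bool → ℤ
v when b = if b then v else 0ℤ

infix 5 _when_

when-∧ : ∀ b c u v → (u * v) when (b ∧ c) ≡ (u when b) * (v when c)
when-∧ true  true  u v = refl
when-∧ true  false u v = sym (*-zeroʳ u)
when-∧ false c     u v = sym (*-zeroˡ (v when c))

when-not : ∀ b v → v when not b ≡ v - (v when b)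
when-not true  v = sym (+-inverseʳ v)
when-not false v = sym (+-identityʳ v)

*-when : ∀ b x v → (x * v) when b ≡ x * (v when b)
*-when true  x v = refl
*-when false x v = sym (*-zeroʳ x)

Disjoint : Subset k → Subset k → Set
Disjoint p q = ∀ {i} → i ∈ p → i ∈ q → ⊥

Disjoint-tail : ∀ {s t} {p q : Subset k} → Disjoint (s ∷ p) (t ∷ q) → Disjoint p q
Disjoint-tail disj i∈p i∈q = disj (there i∈p) (there i∈q)

∣p∪q∣≡∣p∣+∣q∣ : (p q : Subset k) → Disjoint p q → ∣ p ∪ q ∣ ≡ ∣ p ∣ ℕ.+ ∣ q ∣
∣p∪q∣≡∣p∣+∣q∣ []            []            disj = refl
∣p∪q∣≡∣p∣+∣q∣ (outside ∷ p) (outside ∷ q) disj = ∣p∪q∣≡∣p∣+∣q∣ p q (Disjoint-tail disj)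
∣p∪q∣≡∣p∣+∣q∣ (inside ∷ p)  (outside ∷ q) disj = cong ℕ.suc (∣p∪q∣≡∣p∣+∣q∣ p q (Disjoint-tail disj))
∣p∪q∣≡∣p∣+∣q∣ (outside ∷ p) (inside ∷ q)  disj =
  trans (cong ℕ.suc (∣p∪q∣≡∣p∣+∣q∣ p q (Disjoint-tail disj))) (sym (+-suc ∣ p ∣ ∣ q ∣))
∣p∪q∣≡∣p∣+∣q∣ (inside ∷ p)  (inside ∷ q)  disj = ⊥-elim (disj here here)

x∈p─q⇒x∉q : (p q : Subset k) {x : Fin k} → x ∈ p ─ q → x ∉ q
x∈p─q⇒x∉q (s ∷ p) (inside ∷ q)  ()          here
x∈p─q⇒x∉q (s ∷ p) (inside ∷ q)  (there x∈) (there x∈q) = x∈p─q⇒x∉q p q x∈ x∈q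
x∈p─q⇒x∉q (s ∷ p) (outside ∷ q) (there x∈) (there x∈q) = x∈p─q⇒x∉q p q x∈ x∈q

⊈⇒∃∈∉ : (p q : Subset k) → ¬ (p ⊆ q) → ∃ λ x → x ∈ p × x ∉ q
⊈⇒∃∈∉ []           []            p⊈q = ⊥-elim (p⊈q (λ ()))
⊈⇒∃∈∉ (inside ∷ p) (outside ∷ q) p⊈q = zero , here , λ ()
⊈⇒∃∈∉ (outside ∷ p) (t ∷ q)      p⊈q with ⊈⇒∃∈∉ p q (λ p⊆q → p⊈q (out⊆ p⊆q))
... | x , x∈p , x∉q = suc x , there x∈p , λ x∈ → x∉q (drop-there x∈)
⊈⇒∃∈∉ (inside ∷ p) (inside ∷ q)  p⊈q with ⊈⇒∃∈∉ p q (λ p⊆q → p⊈q (in⊆in p⊆q))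
... | x , x∈p , x∉q = suc x , there x∈p , λ x∈ → x∉q (drop-there x∈)

∪-∩-cancel : (p q r : Subset k) → p ⊆ r → Disjoint q r → (p ∪ q) ∩ r ≡ p
∪-∩-cancel p q r p⊆r disj = ⊆-antisym ⊆p (λ x∈p → x∈p∩q⁺ (p⊆p∪q q x∈p , p⊆r x∈p))
  where
  ⊆p : (p ∪ q) ∩ r ⊆ p
  ⊆p x∈ with x∈p∩q⁻ (p ∪ q) r x∈
  ... | x∈p∪q , x∈r with x∈p∪q⁻ p q x∈p∪q
  ...   | inj₁ x∈p = x∈p
  ...   | inj₂ x∈q = ⊥-elim (disj x∈q x∈r)

∑⊆ : Subset k → (Subset k → ℤ) → ℤ
∑⊆ []            f = f []
∑⊆ (outside ∷ D) f = ∑⊆ D (λ S → f (outside ∷ S))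
∑⊆ (inside ∷ D)  f = ∑⊆ D (λ S → f (outside ∷ S)) + ∑⊆ D (λ S → f (inside ∷ S))

syntax ∑⊆ D (λ S → e) = ∑[ S ⊆ D ] e

∑⊆-cong : (D : Subset k) {f g : Subset k → ℤ} → (∀ S → S ⊆ D → f S ≡ g S) → ∑⊆ D f ≡ ∑⊆ D g
∑⊆-cong []            f≗g = f≗g [] (λ ())
∑⊆-cong (outside ∷ D) f≗g = ∑⊆-cong D (λ S S⊆D → f≗g _ (out⊆ S⊆D))
∑⊆-cong (inside ∷ D)  f≗g =
  cong₂ _+_ (∑⊆-cong D (λ S S⊆D → f≗g _ (out⊆ S⊆D))) (∑⊆-cong D (λ S S⊆D → f≗g _ (s⊆s S⊆D)))

∑⊆-zero : (D : Subset k) {f : Subset k → ℤ} → (∀ S → f S ≡ 0ℤ) → ∑⊆ D f ≡ 0ℤ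
∑⊆-zero []            f≗0 = f≗0 []
∑⊆-zero (outside ∷ D) f≗0 = ∑⊆-zero D (λ S → f≗0 _)
∑⊆-zero (inside ∷ D)  f≗0 = cong₂ _+_ (∑⊆-zero D (λ S → f≗0 _)) (∑⊆-zero D (λ S → f≗0 _))

∑⊆-+ : (D : Subset k) (f g : Subset k → ℤ) → ∑[ S ⊆ D ] (f S + g S) ≡ ∑⊆ D f + ∑⊆ D g
∑⊆-+ []            f g = refl
∑⊆-+ (outside ∷ D) f g = ∑⊆-+ D _ _
∑⊆-+ (inside ∷ D)  f g =
  trans (cong₂ _+_ (∑⊆-+ D _ _) (∑⊆-+ D _ _))
        (interchange +-commutativeSemigroup (∑⊆ D (λ S → f (outside ∷ S))) _ _ _)

∑⊆-neg : (D : Subset k) (f : Subset k → ℤ) → ∑[ S ⊆ D ] (- f S) ≡ - ∑⊆ D f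
∑⊆-neg []            f = refl
∑⊆-neg (outside ∷ D) f = ∑⊆-neg D _
∑⊆-neg (inside ∷ D)  f =
  trans (cong₂ _+_ (∑⊆-neg D _) (∑⊆-neg D _)) (sym (neg-distrib-+ (∑⊆ D (λ S → f (outside ∷ S))) _))

∑⊆-*ˡ : (D : Subset k) (c : ℤ) (f : Subset k → ℤ) → ∑[ S ⊆ D ] (c * f S) ≡ c * ∑⊆ D f
∑⊆-*ˡ []            c f = refl
∑⊆-*ˡ (outside ∷ D) c f = ∑⊆-*ˡ D c _
∑⊆-*ˡ (inside ∷ D)  c f =
  trans (cong₂ _+_ (∑⊆-*ˡ D c _) (∑⊆-*ˡ D c _)) (sym (*-distribˡ-+ c (∑⊆ D (λ S → f (outside ∷ S))) _))

∑⊆-*ʳ : (D : Subset k) (c : ℤ) (f : Subset k → ℤ) → ∑[ S ⊆ D ] (f S * c) ≡ ∑⊆ D f * c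
∑⊆-*ʳ []            c f = refl
∑⊆-*ʳ (outside ∷ D) c f = ∑⊆-*ʳ D c _
∑⊆-*ʳ (inside ∷ D)  c f =
  trans (cong₂ _+_ (∑⊆-*ʳ D c _) (∑⊆-*ʳ D c _)) (sym (*-distribʳ-+ c (∑⊆ D (λ S → f (outside ∷ S))) _))

∑⊆-product : (D E : Subset k) (f g : Subset k → ℤ) →
  ∑[ S ⊆ D ] (∑[ T ⊆ E ] (f S * g T)) ≡ ∑⊆ D f * ∑⊆ E g
∑⊆-product D E f g = begin
  ∑[ S ⊆ D ] (∑[ T ⊆ E ] (f S * g T)) ≡⟨ ∑⊆-cong D (λ S _ → ∑⊆-*ˡ E (f S) g) ⟩
  ∑[ S ⊆ D ] (f S * ∑⊆ E g)          ≡⟨ ∑⊆-*ʳ D (∑⊆ E g) f ⟩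
  ∑⊆ D f * ∑⊆ E g                    ∎
  where open ≡-Reasoning

∑⊆-∪ : (D E : Subset k) (f : Subset k → ℤ) → Disjoint D E →
  ∑⊆ (D ∪ E) f ≡ ∑[ S ⊆ D ] (∑[ T ⊆ E ] f (S ∪ T))
∑⊆-∪ []            []            f disj = refl
∑⊆-∪ (outside ∷ D) (outside ∷ E) f disj = ∑⊆-∪ D E _ (Disjoint-tail disj)
∑⊆-∪ (inside ∷ D)  (outside ∷ E) f disj =
  cong₂ _+_ (∑⊆-∪ D E _ (Disjoint-tail disj)) (∑⊆-∪ D E _ (Disjoint-tail disj))
∑⊆-∪ (outside ∷ D) (inside ∷ E)  f disj =
  trans (cong₂ _+_ (∑⊆-∪ D E _ (Disjoint-tail disj)) (∑⊆-∪ D E _ (Disjoint-tail disj)))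
        (sym (∑⊆-+ D _ _))
∑⊆-∪ (inside ∷ D)  (inside ∷ E)  f disj = ⊥-elim (disj here here)

∑⊆-restrict : (D : Subset k) (f : Subset k → ℤ) → (∀ S → ¬ S ⊆ D → f S ≡ 0ℤ) →
  ∑⊆ ⊤ f ≡ ∑⊆ D f
∑⊆-restrict []            f f≗0 = refl
∑⊆-restrict (outside ∷ D) f f≗0 =
  trans (cong₂ _+_ (∑⊆-restrict D _ (λ S S⊈D → f≗0 _ (λ S⊆D → S⊈D (drop-∷-⊆ S⊆D))))
                   (∑⊆-zero ⊤ {λ S → f (inside ∷ S)} (λ S → f≗0 _ (λ S⊆D → 0∉ (S⊆D here)))))
        (+-identityʳ _)
  where
  0∉ : zero ∉ outside ∷ D
  0∉ ()
∑⊆-restrict (inside ∷ D)  f f≗0 =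
  cong₂ _+_ (∑⊆-restrict D _ (λ S S⊈D → f≗0 _ (λ S⊆D → S⊈D (drop-∷-⊆ S⊆D))))
            (∑⊆-restrict D _ (λ S S⊈D → f≗0 _ (λ S⊆D → S⊈D (drop-∷-⊆ S⊆D))))

∑⊆-binomial : (C : Subset k) (x : ℤ) → ∑[ S ⊆ C ] (x ^ ∣ S ∣) ≡ (1ℤ + x) ^ ∣ C ∣
∑⊆-binomial []            x = refl
∑⊆-binomial (outside ∷ C) x = ∑⊆-binomial C x
∑⊆-binomial (inside ∷ C)  x = begin
  ∑[ S ⊆ C ] (x ^ ∣ S ∣) + ∑[ S ⊆ C ] (x * x ^ ∣ S ∣) ≡⟨ cong (∑⊆ C (λ S → x ^ ∣ S ∣) +_) (∑⊆-*ˡ C x _) ⟩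
  p + x * p                                         ≡⟨ cong (_+ x * p) (sym (*-identityˡ p)) ⟩
  1ℤ * p + x * p                                    ≡⟨ *-distribʳ-+ p 1ℤ x ⟨
  (1ℤ + x) * p                                      ≡⟨ cong ((1ℤ + x) *_) (∑⊆-binomial C x) ⟩
  (1ℤ + x) * (1ℤ + x) ^ ∣ C ∣                        ∎
  where
  open ≡-Reasoning
  p : ℤ
  p = ∑[ S ⊆ C ] (x ^ ∣ S ∣)

∑⊆-when-*ˡ : (D : Subset k) (b : Subset k → Bool) (x : ℤ) (f : Subset k → ℤ) →
  ∑[ S ⊆ D ] ((x * f S) when b S) ≡ x * ∑[ S ⊆ D ] (f S when b S)
∑⊆-when-*ˡ D b x f = trans (∑⊆-cong D (λ S _ → *-when (b S) x (f S))) (∑⊆-*ˡ D x _)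

∑⊆-supersets : (A C : Subset k) (x : ℤ) → A ⊆ C →
  ∑[ S ⊆ C ] (x ^ ∣ S ∣ when does (A ⊆? S)) ≡ x ^ ∣ A ∣ * (1ℤ + x) ^ (∣ C ∣ ∸ ∣ A ∣)
∑⊆-supersets []            []            x A⊆C = refl
∑⊆-supersets (outside ∷ A) (outside ∷ C) x A⊆C = ∑⊆-supersets A C x (drop-∷-⊆ A⊆C)
∑⊆-supersets (outside ∷ A) (inside ∷ C)  x A⊆C = begin
  r + ∑[ S ⊆ C ] ((x * x ^ ∣ S ∣) when does (A ⊆? S))
    ≡⟨ cong (r +_) (∑⊆-when-*ˡ C (λ S → does (A ⊆? S)) x (λ S → x ^ ∣ S ∣)) ⟩
  r + x * r
    ≡⟨ cong (λ t → t + x * t) (∑⊆-supersets A C x (drop-∷-⊆ A⊆C)) ⟩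
  a * q + x * (a * q)
    ≡⟨ solve 3 (λ x a q → a :* q :+ x :* (a :* q) := a :* ((con 1ℤ :+ x) :* q)) refl x a q ⟩
  a * ((1ℤ + x) * q)
    ≡⟨ cong (λ m → a * (1ℤ + x) ^ m) (sym (+-∸-assoc 1 (p⊆q⇒∣p∣≤∣q∣ (drop-∷-⊆ A⊆C)))) ⟩
  a * (1ℤ + x) ^ (ℕ.suc ∣ C ∣ ∸ ∣ A ∣)
    ∎
  where
  open ≡-Reasoning
  open +-*-Solver
  a q r : ℤ
  a = x ^ ∣ A ∣
  q = (1ℤ + x) ^ (∣ C ∣ ∸ ∣ A ∣)
  r = ∑[ S ⊆ C ] (x ^ ∣ S ∣ when does (A ⊆? S))
∑⊆-supersets (inside ∷ A)  (inside ∷ C)  x A⊆C = begin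
  ∑[ S ⊆ C ] (x ^ ∣ S ∣ when false) + ∑[ S ⊆ C ] ((x * x ^ ∣ S ∣) when does (A ⊆? S))
    ≡⟨ cong₂ _+_ (∑⊆-zero C (λ _ → refl)) (∑⊆-when-*ˡ C (λ S → does (A ⊆? S)) x (λ S → x ^ ∣ S ∣)) ⟩
  0ℤ + x * ∑[ S ⊆ C ] (x ^ ∣ S ∣ when does (A ⊆? S))
    ≡⟨ +-identityˡ _ ⟩
  x * ∑[ S ⊆ C ] (x ^ ∣ S ∣ when does (A ⊆? S))
    ≡⟨ cong (x *_) (∑⊆-supersets A C x (drop-∷-⊆ A⊆C)) ⟩
  x * (x ^ ∣ A ∣ * (1ℤ + x) ^ (∣ C ∣ ∸ ∣ A ∣))
    ≡⟨ *-assoc x _ _ ⟨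
  x * x ^ ∣ A ∣ * (1ℤ + x) ^ (∣ C ∣ ∸ ∣ A ∣)
    ∎
  where open ≡-Reasoning
∑⊆-supersets (inside ∷ A)  (outside ∷ C) x A⊆C with A⊆C here
... | ()

∑⊆-nonSupersets : (A C : Subset k) (x : ℤ) → A ⊆ C →
  ∑[ S ⊆ C ] (x ^ ∣ S ∣ when not (does (A ⊆? S)))
    ≡ (1ℤ + x) ^ ∣ C ∣ - x ^ ∣ A ∣ * (1ℤ + x) ^ (∣ C ∣ ∸ ∣ A ∣)
∑⊆-nonSupersets A C x A⊆C = begin
  ∑[ S ⊆ C ] (x ^ ∣ S ∣ when not (does (A ⊆? S)))
    ≡⟨ ∑⊆-cong C (λ S _ → when-not (does (A ⊆? S)) (x ^ ∣ S ∣)) ⟩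
  ∑[ S ⊆ C ] (x ^ ∣ S ∣ - (x ^ ∣ S ∣ when does (A ⊆? S)))
    ≡⟨ ∑⊆-+ C _ _ ⟩
  ∑[ S ⊆ C ] (x ^ ∣ S ∣) + ∑[ S ⊆ C ] (- (x ^ ∣ S ∣ when does (A ⊆? S)))
    ≡⟨ cong₂ _+_ (∑⊆-binomial C x) (∑⊆-neg C _) ⟩
  (1ℤ + x) ^ ∣ C ∣ - ∑[ S ⊆ C ] (x ^ ∣ S ∣ when does (A ⊆? S))
    ≡⟨ cong (λ t → (1ℤ + x) ^ ∣ C ∣ - t) (∑⊆-supersets A C x A⊆C) ⟩
  (1ℤ + x) ^ ∣ C ∣ - x ^ ∣ A ∣ * (1ℤ + x) ^ (∣ C ∣ ∸ ∣ A ∣)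
    ∎
  where open ≡-Reasoning

listSum : {X : Set} → (X → ℤ) → List X → ℤ
listSum h xs = foldr _+_ 0ℤ (map h xs)

listSum-filter : {X : Set} {P : Pred X Agda.Primitive.lzero} (P? : Decidable P) (h : X → ℤ) (xs : List X) →
  listSum h (filter P? xs) ≡ listSum (λ a → h a when does (P? a)) xs
listSum-filter P? h []       = refl
listSum-filter P? h (a ∷ xs) with does (P? a)
... | true  = cong (h a +_) (listSum-filter P? h xs)
... | false = trans (listSum-filter P? h xs) (sym (+-identityˡ _))

listSum-++ : {X : Set} (h : X → ℤ) (xs ys : List X) → listSum h (xs ++ ys) ≡ listSum h xs + listSum h ys
listSum-++ h []       ys = sym (+-identityˡ _)
listSum-++ h (a ∷ xs) ys = trans (cong (h a +_) (listSum-++ h xs ys)) (sym (+-assoc (h a) _ _))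

listSum-map : {X Y : Set} (h : Y → ℤ) (g : X → Y) (xs : List X) → listSum h (map g xs) ≡ listSum (λ a → h (g a)) xs
listSum-map h g []       = refl
listSum-map h g (a ∷ xs) = cong (h (g a) +_) (listSum-map h g xs)

listSum-allSubsets : (k : ℕ) (h : Subset k → ℤ) → listSum h (allSubsets k) ≡ ∑⊆ ⊤ h
listSum-allSubsets ℕ.zero    h = +-identityʳ _
listSum-allSubsets (ℕ.suc k) h = begin
  listSum h (map (outside ∷_) (allSubsets k) ++ map (inside ∷_) (allSubsets k))
    ≡⟨ listSum-++ h (map (outside ∷_) (allSubsets k)) _ ⟩
  listSum h (map (outside ∷_) (allSubsets k)) + listSum h (map (inside ∷_) (allSubsets k))
    ≡⟨ cong₂ _+_ (listSum-map h (outside ∷_) (allSubsets k)) (listSum-map h (inside ∷_) (allSubsets k)) ⟩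
  listSum (λ S → h (outside ∷ S)) (allSubsets k) + listSum (λ S → h (inside ∷ S)) (allSubsets k)
    ≡⟨ cong₂ _+_ (listSum-allSubsets k _) (listSum-allSubsets k _) ⟩
  ∑⊆ ⊤ (λ S → h (outside ∷ S)) + ∑⊆ ⊤ (λ S → h (inside ∷ S))
    ∎
  where open ≡-Reasoning

genFun≡∑⊆ : {P : Pred (Subset k) Agda.Primitive.lzero} (P? : Decidable P) (D : Subset k) (x : ℤ) →
  (∀ {S} → P S → S ⊆ D) → genFun P? x ≡ ∑[ S ⊆ D ] (x ^ ∣ S ∣ when does (P? S))
genFun≡∑⊆ {k} P? D x P⇒⊆D = begin
  genFun P? x                                     ≡⟨ listSum-filter P? (λ S → x ^ ∣ S ∣) (allSubsets k) ⟩
  listSum (λ S → x ^ ∣ S ∣ when does (P? S)) (allSubsets k) ≡⟨ listSum-allSubsets k _ ⟩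
  ∑[ S ⊆ ⊤ ] (x ^ ∣ S ∣ when does (P? S))        ≡⟨ ∑⊆-restrict D _ vanishes ⟩
  ∑[ S ⊆ D ] (x ^ ∣ S ∣ when does (P? S))        ∎
  where
  open ≡-Reasoning
  vanishes : ∀ S → ¬ S ⊆ D → x ^ ∣ S ∣ when does (P? S) ≡ 0ℤ
  vanishes S S⊈D with P? S
  ... | yes PS = ⊥-elim (S⊈D (P⇒⊆D PS))
  ... | no _   = refl

module _ {n : ℕ} (G : Graph n) where
  open Graph G using (adj; irrefl) renaming (sym to adj-sym)

  Nbh⁺ : ∀ {v u} → adj v u ≡ true → u ∈ Nbh G v
  Nbh⁺ {v} {u} vu = lookup⇒[]= u (Nbh G v) (trans (lookup∘tabulate (adj v) u) vu)

  Nbh⁻ : ∀ {v u} → u ∈ Nbh G v → adj v u ≡ true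
  Nbh⁻ {v} {u} u∈ = trans (sym (lookup∘tabulate (adj v) u)) ([]=⇒lookup u∈)

  private
    elems⁺ : ∀ {W w} → w ∈ W → w List.∈ elems G W
    elems⁺ {W} {w} w∈W = ∈-filter⁺ (_∈? W) (∈-allFin w) w∈W

    elems⁻ : ∀ {W w} → w List.∈ elems G W → w ∈ W
    elems⁻ {W} w∈ = proj₂ (∈-filter⁻ (_∈? W) {xs = allFin n} w∈)

    ⋂Nbh⁺ : ∀ ws {u} → (∀ {w} → w List.∈ ws → adj w u ≡ true) → u ∈ ⋂ (map (Nbh G) ws)
    ⋂Nbh⁺ []       adj-ws = ∈⊤
    ⋂Nbh⁺ (w ∷ ws) adj-ws = x∈p∩q⁺ (Nbh⁺ (adj-ws (here refl)) , ⋂Nbh⁺ ws (λ w∈ → adj-ws (there w∈)))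

    ⋂Nbh⁻ : ∀ ws {u w} → u ∈ ⋂ (map (Nbh G) ws) → w List.∈ ws → adj w u ≡ true
    ⋂Nbh⁻ (w ∷ ws) u∈ (here refl) = Nbh⁻ (proj₁ (x∈p∩q⁻ _ _ u∈))
    ⋂Nbh⁻ (w ∷ ws) u∈ (there w∈)  = ⋂Nbh⁻ ws (proj₂ (x∈p∩q⁻ _ _ u∈)) w∈

    ⋃Nbh⁺ : ∀ ws {u w} → w List.∈ ws → adj w u ≡ true → u ∈ ⋃ (map (Nbh G) ws)
    ⋃Nbh⁺ (w ∷ ws) (here refl) wu = x∈p∪q⁺ (inj₁ (Nbh⁺ wu))
    ⋃Nbh⁺ (w ∷ ws) (there w∈)  wu = x∈p∪q⁺ (inj₂ (⋃Nbh⁺ ws w∈ wu))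

  Ncap⁺ : ∀ {W u} → (∀ {w} → w ∈ W → adj w u ≡ true) → u ∈ Ncap G W
  Ncap⁺ {W} adj-W = ⋂Nbh⁺ (elems G W) (λ w∈ → adj-W (elems⁻ w∈))

  Ncap⁻ : ∀ {W u w} → u ∈ Ncap G W → w ∈ W → adj w u ≡ true
  Ncap⁻ {W} u∈ w∈W = ⋂Nbh⁻ (elems G W) u∈ (elems⁺ w∈W)

  Ncup⁺ : ∀ {W u w} → w ∈ W → adj w u ≡ true → u ∈ Ncup G W
  Ncup⁺ {W} w∈W wu = ⋃Nbh⁺ (elems G W) (elems⁺ w∈W) wu

  Periphery-disjoint : (C : Subset n) → Disjoint (Periphery G C) C
  Periphery-disjoint C = x∈p─q⇒x∉q (Ncup G C) C

  module _ {C A : Subset n} where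
    private
      Per : Subset n
      Per = Periphery G C

    InNA⇒⊆Periphery∪ : ∀ {N} → InNA G A C N → N ⊆ Per ∪ C
    InNA⇒⊆Periphery∪ ((v , v∈C , N⊆Nv) , _) {u} u∈N with u ∈? C
    ... | yes u∈C = x∈p∪q⁺ (inj₂ u∈C)
    ... | no  u∉C = x∈p∪q⁺ (inj₁ (x∈p∧x∉q⇒x∈p─q (Ncup⁺ v∈C (Nbh⁻ (N⊆Nv u∈N))) u∉C))

    ∪-∩-Periphery : ∀ {M S} → M ⊆ Per → S ⊆ C → (M ∪ S) ∩ Per ≡ M
    ∪-∩-Periphery {M} {S} M⊆Per S⊆C =
      ∪-∩-cancel M S Per M⊆Per (λ x∈S x∈Per → Periphery-disjoint C x∈Per (S⊆C x∈S))

    InNA-split⁻ : ∀ {M S} → M ⊆ Per → S ⊆ C → InNA G A C (M ∪ S) → InP G A C M × ¬ A ⊆ S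
    InNA-split⁻ {M} {S} M⊆Per S⊆C ((v , v∈C , M∪S⊆Nv) , inP) = inP′ , A⊈S
      where
      inP′ : InP G A C M
      inP′ = subst (InP G A C) (∪-∩-Periphery M⊆Per S⊆C) inP
      v∈A : v ∈ A
      v∈A = subst (v ∈_) (proj₂ inP′)
        (x∈p∩q⁺ (Ncap⁺ (λ {w} w∈M → trans (adj-sym w v) (Nbh⁻ (M∪S⊆Nv (p⊆p∪q S w∈M)))) , v∈C))
      A⊈S : ¬ A ⊆ S
      A⊈S A⊆S with trans (sym (irrefl v)) (Nbh⁻ (M∪S⊆Nv (q⊆p∪q M S (A⊆S v∈A))))
      ... | ()

    InNA-split⁺ : IsClique G C → ∀ {M S} → M ⊆ Per → S ⊆ C → InP G A C M → ¬ A ⊆ S →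
      InNA G A C (M ∪ S)
    InNA-split⁺ clique {M} {S} M⊆Per S⊆C inP A⊈S with ⊈⇒∃∈∉ A S A⊈S
    ... | v , v∈A , v∉S = (v , v∈C , M∪S⊆Nv) , subst (InP G A C) (sym (∪-∩-Periphery M⊆Per S⊆C)) inP
      where
      v∈Anchor : v ∈ Anchor G M C
      v∈Anchor = subst (v ∈_) (sym (proj₂ inP)) v∈A
      v∈C : v ∈ C
      v∈C = proj₂ (x∈p∩q⁻ (Ncap G M) C v∈Anchor)
      M∪S⊆Nv : M ∪ S ⊆ Nbh G v
      M∪S⊆Nv {u} u∈ with x∈p∪q⁻ M S u∈
      ... | inj₁ u∈M = Nbh⁺ (trans (adj-sym v u) (Ncap⁻ (proj₁ (x∈p∩q⁻ (Ncap G M) C v∈Anchor)) u∈M))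
      ... | inj₂ u∈S = Nbh⁺ (clique v u v∈C (S⊆C u∈S) (λ { refl → v∉S u∈S }))

    InNA-term-split : IsClique G C → ∀ {M S} → M ⊆ Per → S ⊆ C → (x : ℤ) →
      x ^ ∣ M ∪ S ∣ when does (InNA? G A C (M ∪ S))
        ≡ (x ^ ∣ M ∣ when does (InP? G A C M)) * (x ^ ∣ S ∣ when not (does (A ⊆? S)))
    InNA-term-split clique {M} {S} M⊆Per S⊆C x = begin
      x ^ ∣ M ∪ S ∣ when does (InNA? G A C (M ∪ S))
        ≡⟨ cong₂ _when_ x^∣M∪S∣ (does-⇔ InNA⇔ (InNA? G A C (M ∪ S)) (InP? G A C M ×-dec ¬? (A ⊆? S))) ⟩
      x ^ ∣ M ∣ * x ^ ∣ S ∣ when (does (InP? G A C M) ∧ not (does (A ⊆? S)))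
        ≡⟨ when-∧ (does (InP? G A C M)) _ _ _ ⟩
      (x ^ ∣ M ∣ when does (InP? G A C M)) * (x ^ ∣ S ∣ when not (does (A ⊆? S)))
        ∎
      where
      open ≡-Reasoning
      x^∣M∪S∣ : x ^ ∣ M ∪ S ∣ ≡ x ^ ∣ M ∣ * x ^ ∣ S ∣
      x^∣M∪S∣ = trans (cong (x ^_) (∣p∪q∣≡∣p∣+∣q∣ M S (λ x∈M x∈S → Periphery-disjoint C (M⊆Per x∈M) (S⊆C x∈S))))
                      (^-distribˡ-+-* x ∣ M ∣ ∣ S ∣)
      InNA⇔ : InNA G A C (M ∪ S) ⇔ (InP G A C M × ¬ A ⊆ S)
      InNA⇔ = mk⇔ (InNA-split⁻ M⊆Per S⊆C) (λ (inP , A⊈S) → InNA-split⁺ clique M⊆Per S⊆C inP A⊈S)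

lemma9 : (n : ℕ) (G : Graph n) (C A : Subset n) → IsClique G C → IsAnchorSet G A C →
    (x : ℤ) →
      NGen G A C x ≡ PGen G A C x * ((1ℤ + x) ^ ∣ C ∣ - (x ^ ∣ A ∣) * (1ℤ + x) ^ (∣ C ∣ ∸ ∣ A ∣))
lemma9 n G C A clique (_ , M₀ , _ , A≡Anchor) x = begin
  NGen G A C x
    ≡⟨ genFun≡∑⊆ (InNA? G A C) (Per ∪ C) x (InNA⇒⊆Periphery∪ G) ⟩
  ∑[ N ⊆ Per ∪ C ] (x ^ ∣ N ∣ when does (InNA? G A C N))
    ≡⟨ ∑⊆-∪ Per C _ (Periphery-disjoint G C) ⟩
  ∑[ M ⊆ Per ] (∑[ S ⊆ C ] (x ^ ∣ M ∪ S ∣ when does (InNA? G A C (M ∪ S))))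
    ≡⟨ ∑⊆-cong Per (λ M M⊆Per → ∑⊆-cong C (λ S S⊆C → InNA-term-split G clique M⊆Per S⊆C x)) ⟩
  ∑[ M ⊆ Per ] (∑[ S ⊆ C ] ((x ^ ∣ M ∣ when does (InP? G A C M)) * (x ^ ∣ S ∣ when not (does (A ⊆? S)))))
    ≡⟨ ∑⊆-product Per C _ _ ⟩
  ∑[ M ⊆ Per ] (x ^ ∣ M ∣ when does (InP? G A C M)) * ∑[ S ⊆ C ] (x ^ ∣ S ∣ when not (does (A ⊆? S)))
    ≡⟨ cong₂ _*_ (sym (genFun≡∑⊆ (InP? G A C) Per x proj₁)) (∑⊆-nonSupersets A C x A⊆C) ⟩
  PGen G A C x * ((1ℤ + x) ^ ∣ C ∣ - (x ^ ∣ A ∣) * (1ℤ + x) ^ (∣ C ∣ ∸ ∣ A ∣))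
    ∎
  where
  open ≡-Reasoning
  Per : Subset n
  Per = Periphery G C
  A⊆C : A ⊆ C
  A⊆C a∈A = p∩q⊆q (Ncap G M₀) C (subst (_ ∈_) A≡Anchor a∈A)
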